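{- Let $H=(V,E)$ be a hypergraph with $|V|\ge 4$ and $V \notin E$. Suppose that for every set $F \subseteq E$ of hyperedges, $\left|\bigcup_{e\in F} e\right|\ge \sum_{e\in F}(|e|-1)$. Then there exists a set $W\subseteq V$ with $|W|\le 2$ such that the graph $G_2^H-W$ is disconnected.
   Context: A hypergraph is a pair $(V,E)$ with $V$ a finite set and $E \subseteq 2^V\setminus\{\emptyset\}$. The $2$-section $G_2^H$ of $H$ is the graph on vertex set $V$ in which $uv$ is an edge (for distinct $u,v$) if and only if there is some $e\in E$ with $u,v\in e$. For $W\subseteq V$, $G_2^H-W$ denotes the graph obtained by deleting the vertices of $W$. -}

module Defs where

open import Data.Nat using (ℕ; _∸_; _≤_)
open import Data.Fin using (Fin)
open import Data.Fin.Subset as S using (Subset; ⊤; ⋃; ∣_∣; Nonempty; _∉_)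
open import Data.List using (List; map)
open import Data.Nat.ListAction using (sum)
open import Data.List.Membership.Propositional as L using ()
open import Data.List.Relation.Unary.All using (All)
open import Data.List.Relation.Unary.Unique.Propositional using (Unique)
open import Data.List.Relation.Binary.Sublist.Propositional using (_⊆_)
open import Data.Product using (Σ; ∃; _×_)
open import Relation.Nullary using (¬_)
open import Relation.Binary.PropositionalEquality using (_≢_)
open import Relation.Binary.Construct.Closure.ReflexiveTransitive using (Star)

record Hypergraph (n : ℕ) : Set where
  field
    edges    : List (Subset n)
    unique   : Unique edges
    nonempty : All Nonempty edges

open Hypergraph public

-- Sets F ⊆ E of hyperedges are sublists of the (duplicate-free) edge list.
-- Union of the hyperedges of F.
unionOf : ∀ {n} → List (Subset n) → Subset n
unionOf F = ⋃ F

-- Σ_{e ∈ F} (|e| - 1)   (each |e| ≥ 1, so truncated subtraction is exact)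
excessSum : ∀ {n} → List (Subset n) → ℕ
excessSum F = sum (map (λ e → ∣ e ∣ ∸ 1) F)

UnionCondition : ∀ {n} → Hypergraph n → Set
UnionCondition H = ∀ F → F ⊆ edges H → excessSum F ≤ ∣ unionOf F ∣

Adj2 : ∀ {n} → Hypergraph n → Fin n → Fin n → Set
Adj2 H u v = u ≢ v × ∃ λ e → e L.∈ edges H × u S.∈ e × v S.∈ e

AdjMinus : ∀ {n} → Hypergraph n → Subset n → Fin n → Fin n → Set
AdjMinus H W u v = u ∉ W × v ∉ W × Adj2 H u v

Disconnected : ∀ {n} → Hypergraph n → Subset n → Set
Disconnected H W =
  ∃ λ u → ∃ λ v → u ∉ W × v ∉ W × ¬ Star (AdjMinus H W) u v

{-# OPTIONS --safe #-}
module Submission where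

-- Discard the hyperedges with fewer than two vertices and let d(v) be the number of
-- remaining hyperedges through v; call v heavy if d(v) ≥ 2. Double counting turns the
-- union condition for all remaining hyperedges into Σᵥ (d(v) ∸ 1) ≤ |E|, and hence
--   Σₑ |e ∩ heavy| + Σᵥ (d(v) ∸ 2) = 2 Σᵥ (d(v) ∸ 1) ≤ 2 |E|.
-- If some hyperedge e has a light vertex and at most two heavy ones, deleting e ∩ heavy
-- cuts the light vertices of e off from a vertex outside e, which exists as V ∉ E.
-- Otherwise every hyperedge has at least two heavy vertices, the inequality is tight,
-- so all degrees are at most 2 and all hyperedges have exactly two vertices: every
-- vertex has at most two neighbours, and deleting them isolates it since |V| ≥ 4.

open import Defs
open import Data.Nat using (ℕ; _≤_)
open import Data.Fin.Subset using (Subset; ⊤; ∣_∣)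
open import Data.List.Membership.Propositional using (_∉_)
open import Data.Product using (∃; _×_)

open import Data.Nat.Properties
open import Algebra.Properties.CommutativeMonoid.Sum +-0-commutativeMonoid
  using (sum-syntax; ∑-distrib-+; sum-cong-≗; sum-replicate-zero)
open import Algebra.Properties.CommutativeSemigroup +-commutativeSemigroup using (interchange)
open import Data.Bool using (if_then_else_)
open import Data.Empty using (⊥-elim)
open import Data.Fin using (Fin; zero; suc)
open import Data.Fin.Subset
  using (_∩_; _∪_; _─_; _-_; ⋃; ⁅_⁆; Empty; Nonempty; inside; outside)
  renaming (_∈_ to _∈ₛ_; _∉_ to _∉ₛ_)
open import Data.Fin.Subset.Properties
  using (_∈?_; nonempty?; ∈⊤; ∉⊥; drop-there; x∈⁅x⁆; x∈⁅y⁆⇔x≡y; Empty-unique;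
         x∈p∩q⁺; x∈p∩q⁻; x∈p∪q⁺; x∈p∪q⁻; p─q⊆p; x∈p∧x≢y⇒x∈p-y; ∩-identityʳ;
         ∣⊥∣≡0; ∣⁅x⁆∣≡1; ∣p∣≤n; ∣p∣≤∣x∷p∣; ∣p∣≡n⇒p≡⊤; ∣p∩q∣≤∣p∣; x∈p⇒∣p-x∣<∣p∣)
open import Data.List using (List; []; _∷_; map; length; filter)
open import Data.List.Membership.Propositional using (_∈_; find; lose)
open import Data.List.Membership.Propositional.Properties
  using (∈-filter⁺; ∈-filter⁻; ∈-map⁺; ∈-map⁻)
open import Data.List.Properties using (map-∘)
open import Data.List.Relation.Binary.Sublist.Propositional.Properties using (filter-⊆)
open import Data.List.Relation.Unary.Any using (Any; any?; here; there)
open import Data.Nat using (zero; suc; _+_; _*_; _∸_; _<_; z≤n; s≤s; _≤?_)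
open import Data.Nat.ListAction using (sum)
open import Data.Product using (_,_; proj₁; proj₂)
import Data.Product as Product
open import Data.Sum using (inj₁; inj₂; [_,_])
open import Data.Vec using ([]; _∷_; here; there; tabulate)
open import Data.Vec.Properties using ([]=⇒lookup; lookup⇒[]=; lookup∘tabulate)
open import Function using (_∘_; id; flip)
open import Function.Bundles using (_⇔_; mk⇔; Equivalence)
open import Relation.Binary.Construct.Closure.ReflexiveTransitive using (Star; fold)
open import Relation.Binary.PropositionalEquality
  using (_≡_; _≢_; refl; sym; trans; cong; cong₂; subst; module ≡-Reasoning)
open import Relation.Nullary using (Dec; does; ¬_; yes; no)
open import Relation.Nullary.Decidable using (_×-dec_; dec-true; dec-false; does-⇔)
open import Relation.Unary using (Decidable)

private
  variable
    n : ℕ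
    x y : Fin n
    p q : Subset n

∑ˡ : {A : Set} → List A → (A → ℕ) → ℕ
∑ˡ xs f = sum (map f xs)

infixl 10 ∑ˡ
syntax ∑ˡ xs (λ x → t) = ∑[ x ∈ xs ] t

module _ {A : Set} where

  ∑ˡ-cong : (xs : List A) {f g : A → ℕ} → (∀ {x} → x ∈ xs → f x ≡ g x) →
    ∑[ x ∈ xs ] f x ≡ ∑[ x ∈ xs ] g x
  ∑ˡ-cong []       _   = refl
  ∑ˡ-cong (x ∷ xs) f≡g = cong₂ _+_ (f≡g (here refl)) (∑ˡ-cong xs (f≡g ∘ there))

  ∑ˡ-mono-≤ : (xs : List A) {f g : A → ℕ} → (∀ {x} → x ∈ xs → f x ≤ g x) →
    ∑[ x ∈ xs ] f x ≤ ∑[ x ∈ xs ] g x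
  ∑ˡ-mono-≤ []       _   = z≤n
  ∑ˡ-mono-≤ (x ∷ xs) f≤g = +-mono-≤ (f≤g (here refl)) (∑ˡ-mono-≤ xs (f≤g ∘ there))

  ∑ˡ-distrib-+ : (xs : List A) (f g : A → ℕ) →
    ∑[ x ∈ xs ] (f x + g x) ≡ ∑[ x ∈ xs ] f x + ∑[ x ∈ xs ] g x
  ∑ˡ-distrib-+ []       f g = refl
  ∑ˡ-distrib-+ (x ∷ xs) f g =
    trans (cong (f x + g x +_) (∑ˡ-distrib-+ xs f g)) (interchange (f x) (g x) _ _)

  ∑ˡ-1≡length : (xs : List A) → ∑[ x ∈ xs ] 1 ≡ length xs
  ∑ˡ-1≡length []       = refl
  ∑ˡ-1≡length (x ∷ xs) = cong suc (∑ˡ-1≡length xs)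

  ∑ˡ-∑-comm : (xs : List A) (f : A → Fin n → ℕ) →
    ∑[ x ∈ xs ] ∑[ i < n ] f x i ≡ ∑[ i < n ] ∑[ x ∈ xs ] f x i
  ∑ˡ-∑-comm {n} []       f = sym (sum-replicate-zero n)
  ∑ˡ-∑-comm     (x ∷ xs) f =
    trans (cong (∑[ i < _ ] f x i +_) (∑ˡ-∑-comm xs f)) (sym (∑-distrib-+ (f x) _))

  ∑ˡ-squeeze : (xs : List A) {f g : A → ℕ} → (∀ {x} → x ∈ xs → g x ≤ f x) →
    ∑[ x ∈ xs ] f x ≤ ∑[ x ∈ xs ] g x → ∀ {x} → x ∈ xs → f x ≤ g x
  ∑ˡ-squeeze (y ∷ xs) g≤f ∑f≤∑g (here refl) =
    +-cancelʳ-≤ _ _ _ (≤-trans ∑f≤∑g (+-monoʳ-≤ _ (∑ˡ-mono-≤ xs (g≤f ∘ there))))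
  ∑ˡ-squeeze (y ∷ xs) g≤f ∑f≤∑g (there x∈xs) =
    ∑ˡ-squeeze xs (g≤f ∘ there)
      (+-cancelˡ-≤ _ _ _ (≤-trans ∑f≤∑g (+-monoˡ-≤ _ (g≤f (here refl))))) x∈xs

  ∈-unique-length≤1 : {xs : List A} {a b : A} → length xs ≤ 1 → a ∈ xs → b ∈ xs → a ≡ b
  ∈-unique-length≤1 {_ ∷ []}    _        (here refl) (here refl) = refl
  ∈-unique-length≤1 {_ ∷ _ ∷ _} (s≤s ()) _           _

≤∑ : (f : Fin n → ℕ) (i : Fin n) → f i ≤ ∑[ j < n ] f j
≤∑ f zero    = m≤m+n _ _
≤∑ f (suc i) = ≤-trans (≤∑ (f ∘ suc) i) (m≤n+m _ _)

[_∈ₛ_] : Fin n → Subset n → ℕ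
[ x ∈ₛ p ] = if does (x ∈? p) then 1 else 0

[∈]≡1 : x ∈ₛ p → [ x ∈ₛ p ] ≡ 1
[∈]≡1 x∈p = cong (λ b → if b then 1 else 0) (dec-true (_ ∈? _) x∈p)

[∉]≡0 : x ∉ₛ p → [ x ∈ₛ p ] ≡ 0
[∉]≡0 x∉p = cong (λ b → if b then 1 else 0) (dec-false (_ ∈? _) x∉p)

[∈]-cong : x ∈ₛ p ⇔ x ∈ₛ q → [ x ∈ₛ p ] ≡ [ x ∈ₛ q ]
[∈]-cong p⇔q = cong (λ b → if b then 1 else 0) (does-⇔ p⇔q (_ ∈? _) (_ ∈? _))

∣p∣≡∑[∈p] : (p : Subset n) → ∣ p ∣ ≡ ∑[ i < n ] [ i ∈ₛ p ]
∣p∣≡∑[∈p] []            = refl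
∣p∣≡∑[∈p] (inside  ∷ p) = cong suc (∣p∣≡∑[∈p] p)
∣p∣≡∑[∈p] (outside ∷ p) = ∣p∣≡∑[∈p] p

∣p∣≡∣p∩q∣+∣p─q∣ : (p q : Subset n) → ∣ p ∣ ≡ ∣ p ∩ q ∣ + ∣ p ─ q ∣
∣p∣≡∣p∩q∣+∣p─q∣ []            []            = refl
∣p∣≡∣p∩q∣+∣p─q∣ (inside  ∷ p) (inside  ∷ q) = cong suc (∣p∣≡∣p∩q∣+∣p─q∣ p q)
∣p∣≡∣p∩q∣+∣p─q∣ (inside  ∷ p) (outside ∷ q) =
  trans (cong suc (∣p∣≡∣p∩q∣+∣p─q∣ p q)) (sym (+-suc _ _))
∣p∣≡∣p∩q∣+∣p─q∣ (outside ∷ p) (inside  ∷ q) = ∣p∣≡∣p∩q∣+∣p─q∣ p q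
∣p∣≡∣p∩q∣+∣p─q∣ (outside ∷ p) (outside ∷ q) = ∣p∣≡∣p∩q∣+∣p─q∣ p q

∣p∪q∣≤∣p∣+∣q∣ : (p q : Subset n) → ∣ p ∪ q ∣ ≤ ∣ p ∣ + ∣ q ∣
∣p∪q∣≤∣p∣+∣q∣ []            []            = z≤n
∣p∪q∣≤∣p∣+∣q∣ (inside  ∷ p) (s ∷ q)       =
  s≤s (≤-trans (∣p∪q∣≤∣p∣+∣q∣ p q) (+-monoʳ-≤ _ (∣p∣≤∣x∷p∣ s q)))
∣p∪q∣≤∣p∣+∣q∣ (outside ∷ p) (inside  ∷ q) =
  ≤-trans (s≤s (∣p∪q∣≤∣p∣+∣q∣ p q)) (≤-reflexive (sym (+-suc _ _)))
∣p∪q∣≤∣p∣+∣q∣ (outside ∷ p) (outside ∷ q) = ∣p∪q∣≤∣p∣+∣q∣ p q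

Empty⇒∣p∣≡0 : Empty p → ∣ p ∣ ≡ 0
Empty⇒∣p∣≡0 {n} empty = trans (cong ∣_∣ (Empty-unique empty)) (∣⊥∣≡0 n)

∣p∣<n⇒∃∉ : (p : Subset n) → ∣ p ∣ < n → ∃ λ x → x ∉ₛ p
∣p∣<n⇒∃∉ (outside ∷ p) _           = zero , λ ()
∣p∣<n⇒∃∉ (inside  ∷ p) (s≤s ∣p∣<n) = Product.map suc (_∘ drop-there) (∣p∣<n⇒∃∉ p ∣p∣<n)

x∈p⇒0<∣p∣ : x ∈ₛ p → 0 < ∣ p ∣
x∈p⇒0<∣p∣               here        = s≤s z≤n
x∈p⇒0<∣p∣ {p = s ∷ p} (there x∈p) = ≤-trans (x∈p⇒0<∣p∣ x∈p) (∣p∣≤∣x∷p∣ s p)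

x∈p∧y∈p∧x≢y⇒2≤∣p∣ : x ∈ₛ p → y ∈ₛ p → x ≢ y → 2 ≤ ∣ p ∣
x∈p∧y∈p∧x≢y⇒2≤∣p∣ x∈p y∈p x≢y =
  ≤-trans (s≤s (x∈p⇒0<∣p∣ (x∈p∧x≢y⇒x∈p-y y∈p (x≢y ∘ sym)))) (x∈p⇒∣p-x∣<∣p∣ x∈p)

x∈p─q⇒x∉q : (p q : Subset n) → x ∈ₛ p ─ q → x ∉ₛ q
x∈p─q⇒x∉q (s ∷ p) (outside ∷ q) here      = λ ()
x∈p─q⇒x∉q (s ∷ p) (t       ∷ q) (there m) = x∈p─q⇒x∉q p q m ∘ drop-there

x∈⋃⁺ : {ps : List (Subset n)} → p ∈ ps → x ∈ₛ p → x ∈ₛ ⋃ ps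
x∈⋃⁺ (here refl)  x∈p = x∈p∪q⁺ (inj₁ x∈p)
x∈⋃⁺ (there p∈ps) x∈p = x∈p∪q⁺ (inj₂ (x∈⋃⁺ p∈ps x∈p))

x∈⋃⁻ : (ps : List (Subset n)) → x ∈ₛ ⋃ ps → ∃ λ p → p ∈ ps × x ∈ₛ p
x∈⋃⁻ []       x∈⊥ = ⊥-elim (∉⊥ x∈⊥)
x∈⋃⁻ (p ∷ ps) x∈⋃ with x∈p∪q⁻ p (⋃ ps) x∈⋃
... | inj₁ x∈p   = p , here refl , x∈p
... | inj₂ x∈⋃ps = Product.map₂ (Product.map₁ there) (x∈⋃⁻ ps x∈⋃ps)

∣⋃ps∣≤∑∣p∣ : (ps : List (Subset n)) → ∣ ⋃ ps ∣ ≤ ∑[ p ∈ ps ] ∣ p ∣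
∣⋃ps∣≤∑∣p∣ {n} []       = ≤-reflexive (∣⊥∣≡0 n)
∣⋃ps∣≤∑∣p∣     (p ∷ ps) = ≤-trans (∣p∪q∣≤∣p∣+∣q∣ p (⋃ ps)) (+-monoʳ-≤ _ (∣⋃ps∣≤∑∣p∣ ps))

∈-tabulate-does : {P : Fin n → Set} (P? : Decidable P) → x ∈ₛ tabulate (does ∘ P?) ⇔ P x
∈-tabulate-does {x = x} {P} P? = mk⇔ to from
  where
  to : x ∈ₛ tabulate (does ∘ P?) → P x
  to x∈ with P? x | trans (sym (lookup∘tabulate (does ∘ P?) x)) ([]=⇒lookup x∈)
  ... | yes px | _ = px
  from : P x → x ∈ₛ tabulate (does ∘ P?)
  from px = lookup⇒[]= x _ (trans (lookup∘tabulate (does ∘ P?) x) (dec-true (P? x) px))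

edgesAt : List (Subset n) → Fin n → List (Subset n)
edgesAt F i = filter (i ∈?_) F

degree : List (Subset n) → Fin n → ℕ
degree F i = length (edgesAt F i)

heavy : List (Subset n) → Subset n
heavy F = tabulate (λ i → does (2 ≤? degree F i))

∈-heavy⇔ : (F : List (Subset n)) → x ∈ₛ heavy F ⇔ 2 ≤ degree F x
∈-heavy⇔ F = ∈-tabulate-does (λ i → 2 ≤? degree F i)

∉heavy⇒degree≤1 : (F : List (Subset n)) → x ∉ₛ heavy F → degree F x ≤ 1
∉heavy⇒degree≤1 F x∉heavy = ≤-pred (≰⇒> (x∉heavy ∘ Equivalence.from (∈-heavy⇔ F)))

∑[∈e∩B]≡[∈B]*degree : (F : List (Subset n)) (B : Subset n) (i : Fin n) →
  ∑[ e ∈ F ] [ i ∈ₛ e ∩ B ] ≡ [ i ∈ₛ B ] * degree F i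
∑[∈e∩B]≡[∈B]*degree []      B i = sym (*-zeroʳ [ i ∈ₛ B ])
∑[∈e∩B]≡[∈B]*degree (e ∷ F) B i with i ∈? e
... | yes i∈e =
  trans (cong₂ _+_ [∈e∩B]≡[∈B] (∑[∈e∩B]≡[∈B]*degree F B i)) (sym (*-suc [ i ∈ₛ B ] (degree F i)))
  where
  [∈e∩B]≡[∈B] : [ i ∈ₛ e ∩ B ] ≡ [ i ∈ₛ B ]
  [∈e∩B]≡[∈B] = [∈]-cong (mk⇔ (proj₂ ∘ x∈p∩q⁻ e B) (λ i∈B → x∈p∩q⁺ (i∈e , i∈B)))
... | no i∉e =
  trans (cong (_+ ∑[ f ∈ F ] [ i ∈ₛ f ∩ B ]) ([∉]≡0 (i∉e ∘ proj₁ ∘ x∈p∩q⁻ e B)))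
        (∑[∈e∩B]≡[∈B]*degree F B i)

∑∣e∩B∣≡∑[∈B]*degree : (F : List (Subset n)) (B : Subset n) →
  ∑[ e ∈ F ] ∣ e ∩ B ∣ ≡ ∑[ i < n ] ([ i ∈ₛ B ] * degree F i)
∑∣e∩B∣≡∑[∈B]*degree {n} F B = begin
  ∑[ e ∈ F ] ∣ e ∩ B ∣                  ≡⟨ ∑ˡ-cong F (λ {e} _ → ∣p∣≡∑[∈p] (e ∩ B)) ⟩
  ∑[ e ∈ F ] ∑[ i < n ] [ i ∈ₛ e ∩ B ]  ≡⟨ ∑ˡ-∑-comm F (λ e i → [ i ∈ₛ e ∩ B ]) ⟩
  ∑[ i < n ] ∑[ e ∈ F ] [ i ∈ₛ e ∩ B ]  ≡⟨ sum-cong-≗ (∑[∈e∩B]≡[∈B]*degree F B) ⟩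
  ∑[ i < n ] ([ i ∈ₛ B ] * degree F i)  ∎
  where open ≡-Reasoning

∑∣e∣≡∑degree : (F : List (Subset n)) → ∑[ e ∈ F ] ∣ e ∣ ≡ ∑[ i < n ] degree F i
∑∣e∣≡∑degree {n} F = begin
  ∑[ e ∈ F ] ∣ e ∣                      ≡⟨ ∑ˡ-cong F (λ {e} _ → cong ∣_∣ (sym (∩-identityʳ e))) ⟩
  ∑[ e ∈ F ] ∣ e ∩ ⊤ ∣                  ≡⟨ ∑∣e∩B∣≡∑[∈B]*degree F ⊤ ⟩
  ∑[ i < n ] ([ i ∈ₛ ⊤ ] * degree F i)  ≡⟨ sum-cong-≗ [∈⊤]*degree≡degree ⟩
  ∑[ i < n ] degree F i                 ∎
  where
  open ≡-Reasoning
  [∈⊤]*degree≡degree : ∀ i → [ i ∈ₛ ⊤ ] * degree F i ≡ degree F i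
  [∈⊤]*degree≡degree i =
    trans (cong (_* degree F i) ([∈]≡1 (∈⊤ {x = i}))) (*-identityˡ (degree F i))

degree≡[∈⋃]+degree∸1 : (F : List (Subset n)) (i : Fin n) →
  degree F i ≡ [ i ∈ₛ ⋃ F ] + (degree F i ∸ 1)
degree≡[∈⋃]+degree∸1 []      i = sym (trans (+-identityʳ _) ([∉]≡0 (∉⊥ {x = i})))
degree≡[∈⋃]+degree∸1 (e ∷ F) i with i ∈? e
... | yes i∈e = cong (_+ degree F i) (sym ([∈]≡1 (x∈p∪q⁺ (inj₁ i∈e))))
... | no  i∉e = trans (degree≡[∈⋃]+degree∸1 F i) (cong (_+ (degree F i ∸ 1)) ([∈]-cong ⋃⇔e∪⋃))
  where
  ⋃⇔e∪⋃ : i ∈ₛ ⋃ F ⇔ i ∈ₛ e ∪ ⋃ F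
  ⋃⇔e∪⋃ = mk⇔ (x∈p∪q⁺ ∘ inj₂) ([ ⊥-elim ∘ i∉e , id ] ∘ x∈p∪q⁻ e (⋃ F))

∑degree≡∣⋃∣+∑degree∸1 : (F : List (Subset n)) →
  ∑[ i < n ] degree F i ≡ ∣ ⋃ F ∣ + ∑[ i < n ] (degree F i ∸ 1)
∑degree≡∣⋃∣+∑degree∸1 {n} F = begin
  ∑[ i < n ] degree F i
    ≡⟨ sum-cong-≗ (degree≡[∈⋃]+degree∸1 F) ⟩
  ∑[ i < n ] ([ i ∈ₛ ⋃ F ] + (degree F i ∸ 1))
    ≡⟨ ∑-distrib-+ (λ i → [ i ∈ₛ ⋃ F ]) (λ i → degree F i ∸ 1) ⟩
  ∑[ i < n ] [ i ∈ₛ ⋃ F ] + ∑[ i < n ] (degree F i ∸ 1)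
    ≡⟨ cong (_+ ∑[ i < n ] (degree F i ∸ 1)) (sym (∣p∣≡∑[∈p] (⋃ F))) ⟩
  ∣ ⋃ F ∣ + ∑[ i < n ] (degree F i ∸ 1)
    ∎
  where open ≡-Reasoning

∑degree∸1≤length : (F : List (Subset n)) → (∀ {e} → e ∈ F → 1 ≤ ∣ e ∣) →
  excessSum F ≤ ∣ ⋃ F ∣ → ∑[ i < n ] (degree F i ∸ 1) ≤ length F
∑degree∸1≤length {n} F 1≤∣e∣ excess≤ = +-cancelˡ-≤ ∣ ⋃ F ∣ _ _ (begin
  ∣ ⋃ F ∣ + ∑[ i < n ] (degree F i ∸ 1)  ≡⟨ sym (∑degree≡∣⋃∣+∑degree∸1 F) ⟩
  ∑[ i < n ] degree F i                  ≡⟨ sym (∑∣e∣≡∑degree F) ⟩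
  ∑[ e ∈ F ] ∣ e ∣                       ≡⟨ ∑ˡ-cong F (λ e∈F → sym (m∸n+n≡m (1≤∣e∣ e∈F))) ⟩
  ∑[ e ∈ F ] (∣ e ∣ ∸ 1 + 1)             ≡⟨ ∑ˡ-distrib-+ F (λ e → ∣ e ∣ ∸ 1) (λ _ → 1) ⟩
  excessSum F + ∑[ e ∈ F ] 1             ≡⟨ cong (excessSum F +_) (∑ˡ-1≡length F) ⟩
  excessSum F + length F                 ≤⟨ +-monoˡ-≤ (length F) excess≤ ⟩
  ∣ ⋃ F ∣ + length F                     ∎)
  where open ≤-Reasoning

m+[m∸2]≡[m∸1]+[m∸1] : ∀ {m} → 2 ≤ m → m + (m ∸ 2) ≡ (m ∸ 1) + (m ∸ 1)
m+[m∸2]≡[m∸1]+[m∸1] {suc (suc k)} (s≤s (s≤s _)) = cong suc (sym (+-suc k k))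

[∈heavy]*degree+degree∸2 : (F : List (Subset n)) (i : Fin n) →
  [ i ∈ₛ heavy F ] * degree F i + (degree F i ∸ 2) ≡ (degree F i ∸ 1) + (degree F i ∸ 1)
[∈heavy]*degree+degree∸2 F i with i ∈? heavy F
... | yes i∈heavy =
  trans (cong (_+ (degree F i ∸ 2)) (*-identityˡ (degree F i)))
        (m+[m∸2]≡[m∸1]+[m∸1] (Equivalence.to (∈-heavy⇔ F) i∈heavy))
... | no i∉heavy =
  trans (m≤n⇒m∸n≡0 (≤-trans d≤1 (n≤1+n 1))) (sym (cong₂ _+_ (m≤n⇒m∸n≡0 d≤1) (m≤n⇒m∸n≡0 d≤1)))
  where
  d≤1 : degree F i ≤ 1
  d≤1 = ∉heavy⇒degree≤1 F i∉heavy

∑∣e∩heavy∣+∑degree∸2≡2∑degree∸1 : (F : List (Subset n)) →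
  ∑[ e ∈ F ] ∣ e ∩ heavy F ∣ + ∑[ i < n ] (degree F i ∸ 2) ≡
  ∑[ i < n ] (degree F i ∸ 1) + ∑[ i < n ] (degree F i ∸ 1)
∑∣e∩heavy∣+∑degree∸2≡2∑degree∸1 {n} F = begin
  ∑[ e ∈ F ] ∣ e ∩ heavy F ∣ + ∑[ i < n ] (degree F i ∸ 2)
    ≡⟨ cong (_+ ∑[ i < n ] (degree F i ∸ 2)) (∑∣e∩B∣≡∑[∈B]*degree F (heavy F)) ⟩
  ∑[ i < n ] ([ i ∈ₛ heavy F ] * degree F i) + ∑[ i < n ] (degree F i ∸ 2)
    ≡⟨ sym (∑-distrib-+ (λ i → [ i ∈ₛ heavy F ] * degree F i) (λ i → degree F i ∸ 2)) ⟩
  ∑[ i < n ] ([ i ∈ₛ heavy F ] * degree F i + (degree F i ∸ 2))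
    ≡⟨ sum-cong-≗ ([∈heavy]*degree+degree∸2 F) ⟩
  ∑[ i < n ] ((degree F i ∸ 1) + (degree F i ∸ 1))
    ≡⟨ ∑-distrib-+ (λ i → degree F i ∸ 1) (λ i → degree F i ∸ 1) ⟩
  ∑[ i < n ] (degree F i ∸ 1) + ∑[ i < n ] (degree F i ∸ 1)
    ∎
  where open ≡-Reasoning

-- A + S = 2 Σᵢ (degree i ∸ 1) ≤ 2 |F| ≤ A  forces S = 0 and every summand of A to be 2.
module _ (F : List (Subset n)) (excess≤ : excessSum F ≤ ∣ ⋃ F ∣)
         (2≤∣e∩heavy∣ : ∀ {e} → e ∈ F → 2 ≤ ∣ e ∩ heavy F ∣) where

  private
    A S : ℕ
    A = ∑[ e ∈ F ] ∣ e ∩ heavy F ∣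
    S = ∑[ i < n ] (degree F i ∸ 2)

    A+S≤∑2 : A + S ≤ ∑[ e ∈ F ] 2
    A+S≤∑2 = begin
      A + S                                                      ≡⟨ ∑∣e∩heavy∣+∑degree∸2≡2∑degree∸1 F ⟩
      ∑[ i < n ] (degree F i ∸ 1) + ∑[ i < n ] (degree F i ∸ 1)  ≤⟨ +-mono-≤ X≤m X≤m ⟩
      length F + length F                                        ≡⟨ sym (cong₂ _+_ (∑ˡ-1≡length F) (∑ˡ-1≡length F)) ⟩
      ∑[ e ∈ F ] 1 + ∑[ e ∈ F ] 1                                ≡⟨ sym (∑ˡ-distrib-+ F (λ _ → 1) (λ _ → 1)) ⟩
      ∑[ e ∈ F ] 2                                               ∎
      where
      open ≤-Reasoning
      1≤∣e∣ : ∀ {e} → e ∈ F → 1 ≤ ∣ e ∣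
      1≤∣e∣ {e} e∈F = ≤-trans (<⇒≤ (2≤∣e∩heavy∣ e∈F)) (∣p∩q∣≤∣p∣ e (heavy F))
      X≤m : ∑[ i < n ] (degree F i ∸ 1) ≤ length F
      X≤m = ∑degree∸1≤length F 1≤∣e∣ excess≤

    S≤0 : S ≤ 0
    S≤0 = +-cancelˡ-≤ A S 0 (begin
      A + S         ≤⟨ A+S≤∑2 ⟩
      ∑[ e ∈ F ] 2  ≤⟨ ∑ˡ-mono-≤ F 2≤∣e∩heavy∣ ⟩
      A             ≡⟨ +-identityʳ A ⟨
      A + 0         ∎)
      where open ≤-Reasoning

  degree≤2 : ∀ i → degree F i ≤ 2
  degree≤2 i = m∸n≡0⇒m≤n (n≤0⇒n≡0 (≤-trans (≤∑ (λ j → degree F j ∸ 2) i) S≤0))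

  ∣e∩heavy∣≤2 : ∀ {e} → e ∈ F → ∣ e ∩ heavy F ∣ ≤ 2
  ∣e∩heavy∣≤2 = ∑ˡ-squeeze F 2≤∣e∩heavy∣ (≤-trans (m≤m+n A S) A+S≤∑2)

neighbourhood : List (Subset n) → Fin n → Subset n
neighbourhood F x = ⋃ (map (_- x) (edgesAt F x))

x∉neighbourhood : (F : List (Subset n)) → x ∉ₛ neighbourhood F x
x∉neighbourhood {x = x} F x∈N with x∈⋃⁻ (map (_- x) (edgesAt F x)) x∈N
... | p , p∈ , x∈p with ∈-map⁻ (_- x) p∈
...   | e , _ , refl = x∈p─q⇒x∉q e ⁅ x ⁆ x∈p (x∈⁅x⁆ x)

y∈neighbourhood : (F : List (Subset n)) {e : Subset n} → e ∈ F → x ∈ₛ e → y ∈ₛ e → y ≢ x →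
  y ∈ₛ neighbourhood F x
y∈neighbourhood {x = x} F e∈F x∈e y∈e y≢x =
  x∈⋃⁺ (∈-map⁺ (_- x) (∈-filter⁺ (x ∈?_) e∈F x∈e)) (x∈p∧x≢y⇒x∈p-y y∈e y≢x)

∣neighbourhood∣≤degree : (F : List (Subset n)) (x : Fin n) → (∀ {e} → e ∈ F → ∣ e ∣ ≤ 2) →
  ∣ neighbourhood F x ∣ ≤ degree F x
∣neighbourhood∣≤degree F x ∣e∣≤2 = begin
  ∣ ⋃ (map (_- x) (edgesAt F x)) ∣         ≤⟨ ∣⋃ps∣≤∑∣p∣ (map (_- x) (edgesAt F x)) ⟩
  ∑[ p ∈ map (_- x) (edgesAt F x) ] ∣ p ∣  ≡⟨ cong sum (map-∘ (edgesAt F x)) ⟨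
  ∑[ e ∈ edgesAt F x ] ∣ e - x ∣           ≤⟨ ∑ˡ-mono-≤ (edgesAt F x) ∣e-x∣≤1 ⟩
  ∑[ e ∈ edgesAt F x ] 1                   ≡⟨ ∑ˡ-1≡length (edgesAt F x) ⟩
  degree F x                               ∎
  where
  open ≤-Reasoning
  ∣e-x∣≤1 : ∀ {e} → e ∈ edgesAt F x → ∣ e - x ∣ ≤ 1
  ∣e-x∣≤1 e∈ with e∈F , x∈e ← ∈-filter⁻ (x ∈?_) e∈ =
    ≤-pred (≤-trans (x∈p⇒∣p-x∣<∣p∣ x∈e) (∣e∣≤2 e∈F))

module _ (F : List (Subset n)) (excess≤ : excessSum F ≤ ∣ ⋃ F ∣)
         (2≤∣e∣ : ∀ {e} → e ∈ F → 2 ≤ ∣ e ∣)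
         (light⇒2<∣e∩heavy∣ : ∀ {e} → e ∈ F → Nonempty (e ─ heavy F) → 2 < ∣ e ∩ heavy F ∣) where

  private
    ∣e∩heavy∣≡∣e∣ : ∀ e → Empty (e ─ heavy F) → ∣ e ∩ heavy F ∣ ≡ ∣ e ∣
    ∣e∩heavy∣≡∣e∣ e empty = sym (begin
      ∣ e ∣                              ≡⟨ ∣p∣≡∣p∩q∣+∣p─q∣ e (heavy F) ⟩
      ∣ e ∩ heavy F ∣ + ∣ e ─ heavy F ∣  ≡⟨ cong (∣ e ∩ heavy F ∣ +_) (Empty⇒∣p∣≡0 empty) ⟩
      ∣ e ∩ heavy F ∣ + 0                ≡⟨ +-identityʳ _ ⟩
      ∣ e ∩ heavy F ∣                    ∎)
      where open ≡-Reasoning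

    2≤∣e∩heavy∣ : ∀ {e} → e ∈ F → 2 ≤ ∣ e ∩ heavy F ∣
    2≤∣e∩heavy∣ {e} e∈F with nonempty? (e ─ heavy F)
    ... | yes light = <⇒≤ (light⇒2<∣e∩heavy∣ e∈F light)
    ... | no  empty = subst (2 ≤_) (sym (∣e∩heavy∣≡∣e∣ e empty)) (2≤∣e∣ e∈F)

  ∣e∣≤2 : ∀ {e} → e ∈ F → ∣ e ∣ ≤ 2
  ∣e∣≤2 {e} e∈F with nonempty? (e ─ heavy F)
  ... | yes light = ⊥-elim (<⇒≱ (light⇒2<∣e∩heavy∣ e∈F light) (∣e∩heavy∣≤2 F excess≤ 2≤∣e∩heavy∣ e∈F))
  ... | no  empty = subst (_≤ 2) (∣e∩heavy∣≡∣e∣ e empty) (∣e∩heavy∣≤2 F excess≤ 2≤∣e∩heavy∣ e∈F)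

  ∣neighbourhood∣≤2 : ∀ x → ∣ neighbourhood F x ∣ ≤ 2
  ∣neighbourhood∣≤2 x =
    ≤-trans (∣neighbourhood∣≤degree F x ∣e∣≤2) (degree≤2 F excess≤ 2≤∣e∩heavy∣ x)

-- Hyperedges with fewer than two vertices create no adjacency in the 2-section but
-- would count towards degrees, so the argument works with the others only.
properEdges : Hypergraph n → List (Subset n)
properEdges H = filter (λ e → 2 ≤? ∣ e ∣) (edges H)

∈properEdges⁻ : (H : Hypergraph n) {e : Subset n} → e ∈ properEdges H → e ∈ edges H × 2 ≤ ∣ e ∣
∈properEdges⁻ H = ∈-filter⁻ (λ e → 2 ≤? ∣ e ∣) {xs = edges H}

adjacent⇒proper : (H : Hypergraph n) {e : Subset n} → e ∈ edges H → x ∈ₛ e → y ∈ₛ e → x ≢ y →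
  e ∈ properEdges H
adjacent⇒proper H e∈E x∈e y∈e x≢y =
  ∈-filter⁺ (λ e → 2 ≤? ∣ e ∣) e∈E (x∈p∧y∈p∧x≢y⇒2≤∣p∣ x∈e y∈e x≢y)

Star-closed : {A : Set} {R : A → A → Set} {a b : A} (P : A → Set) →
  (∀ {a b} → P a → R a b → P b) → Star R a b → P a → P b
Star-closed P closed = fold (λ a b → P a → P b) (λ aRb Pb⇒Pc → Pb⇒Pc ∘ flip closed aRb) id

closed⇒disconnected : (H : Hypergraph n) (W : Subset n) (P : Fin n → Set) →
  (∀ {x y} → P x → AdjMinus H W x y → P y) →
  P x → x ∉ₛ W → ¬ P y → y ∉ₛ W → Disconnected H W
closed⇒disconnected H W P closed px x∉W ¬py y∉W =
  _ , _ , x∉W , y∉W , λ path → ¬py (Star-closed P closed path px)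

light-vertex⇒disconnected : (H : Hypergraph n) {e : Subset n} → e ∈ properEdges H → e ≢ ⊤ →
  x ∈ₛ e → x ∉ₛ heavy (properEdges H) → Disconnected H (e ∩ heavy (properEdges H))
light-vertex⇒disconnected {n} H {e} e∈F e≢⊤ x∈e x∉B
  with w , w∉e ← ∣p∣<n⇒∃∉ e (≤∧≢⇒< (∣p∣≤n e) (e≢⊤ ∘ ∣p∣≡n⇒p≡⊤)) =
  closed⇒disconnected H (e ∩ B) Light closed
    (x∈e , x∉B) (x∉B ∘ proj₂ ∘ x∈p∩q⁻ e B) (w∉e ∘ proj₁) (w∉e ∘ proj₁ ∘ x∈p∩q⁻ e B)
  where
  F : List (Subset n)
  F = properEdges H
  B : Subset n
  B = heavy F
  Light : Fin n → Set
  Light z = z ∈ₛ e × z ∉ₛ B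
  closed : ∀ {z b} → Light z → AdjMinus H (e ∩ B) z b → Light b
  closed {z} {b} (z∈e , z∉B) (_ , b∉e∩B , z≢b , f , f∈E , z∈f , b∈f) =
    b∈e , b∉e∩B ∘ x∈p∩q⁺ ∘ (b∈e ,_)
    where
    f≡e : f ≡ e
    f≡e = ∈-unique-length≤1 (∉heavy⇒degree≤1 F z∉B)
      (∈-filter⁺ (z ∈?_) (adjacent⇒proper H f∈E z∈f b∈f z≢b) z∈f) (∈-filter⁺ (z ∈?_) e∈F z∈e)
    b∈e : b ∈ₛ e
    b∈e = subst (b ∈ₛ_) f≡e b∈f

small-neighbourhood⇒disconnected : (H : Hypergraph n) (x : Fin n) →
  ∣ neighbourhood (properEdges H) x ∣ + 1 < n → Disconnected H (neighbourhood (properEdges H) x)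
small-neighbourhood⇒disconnected {n} H x ∣N∣+1<n =
  closed⇒disconnected H N (_≡ x) closed refl (x∉neighbourhood F)
    (w∉N∪x ∘ x∈p∪q⁺ ∘ inj₂ ∘ Equivalence.from x∈⁅y⁆⇔x≡y) (w∉N∪x ∘ x∈p∪q⁺ ∘ inj₁)
  where
  F : List (Subset n)
  F = properEdges H
  N : Subset n
  N = neighbourhood F x
  ∣N∪x∣<n : ∣ N ∪ ⁅ x ⁆ ∣ < n
  ∣N∪x∣<n = begin-strict
    ∣ N ∪ ⁅ x ⁆ ∣      ≤⟨ ∣p∪q∣≤∣p∣+∣q∣ N ⁅ x ⁆ ⟩
    ∣ N ∣ + ∣ ⁅ x ⁆ ∣  ≡⟨ cong (∣ N ∣ +_) (∣⁅x⁆∣≡1 x) ⟩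
    ∣ N ∣ + 1          <⟨ ∣N∣+1<n ⟩
    n                  ∎
    where open ≤-Reasoning
  w∉N∪x : proj₁ (∣p∣<n⇒∃∉ (N ∪ ⁅ x ⁆) ∣N∪x∣<n) ∉ₛ N ∪ ⁅ x ⁆
  w∉N∪x = proj₂ (∣p∣<n⇒∃∉ (N ∪ ⁅ x ⁆) ∣N∪x∣<n)
  closed : ∀ {z b} → z ≡ x → AdjMinus H N z b → b ≡ x
  closed refl (_ , b∉N , x≢b , f , f∈E , x∈f , b∈f) =
    ⊥-elim (b∉N (y∈neighbourhood F (adjacent⇒proper H f∈E x∈f b∈f x≢b) x∈f b∈f (x≢b ∘ sym)))

lemma5 : (n : ℕ) → 4 ≤ n → (H : Hypergraph n) → ⊤ ∉ edges H →
    UnionCondition H →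
    ∃ λ (W : Subset n) → ∣ W ∣ ≤ 2 × Disconnected H W
lemma5 zero    ()
lemma5 (suc n) 4≤n H ⊤∉E union = separate (any? (λ e → nonempty? (e ─ B) ×-dec (∣ e ∩ B ∣ ≤? 2)) F)
  where
  F : List (Subset (suc n))
  F = properEdges H
  B : Subset (suc n)
  B = heavy F
  separate : Dec (Any (λ e → Nonempty (e ─ B) × ∣ e ∩ B ∣ ≤ 2) F) →
    ∃ λ (W : Subset (suc n)) → ∣ W ∣ ≤ 2 × Disconnected H W
  separate (yes light) with e , e∈F , (x , x∈e─B) , ∣e∩B∣≤2 ← find light =
    e ∩ B , ∣e∩B∣≤2 , light-vertex⇒disconnected H e∈F
      (λ e≡⊤ → ⊤∉E (subst (_∈ edges H) e≡⊤ (proj₁ (∈properEdges⁻ H e∈F))))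
      (p─q⊆p e B x∈e─B) (x∈p─q⇒x∉q e B x∈e─B)
  separate (no no-light) =
    neighbourhood F zero , ∣N∣≤2 ,
    small-neighbourhood⇒disconnected H zero (≤-trans (s≤s (+-monoˡ-≤ 1 ∣N∣≤2)) 4≤n)
    where
    ∣N∣≤2 : ∣ neighbourhood F zero ∣ ≤ 2
    ∣N∣≤2 = ∣neighbourhood∣≤2 F (union F (filter-⊆ (λ e → 2 ≤? ∣ e ∣) (edges H)))
      (proj₂ ∘ ∈properEdges⁻ H) (λ e∈F light → ≰⇒> (no-light ∘ lose e∈F ∘ (light ,_))) zero
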